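{- Let $n\geq 4$ and let $x_1,x_2,x_3,x_4$ be nonnegative integers with $x_1+x_2+x_3+x_4=n$. Let $G$ be the graph obtained from the cycle with vertices $0,1,\dots,n-1$ (in this cyclic order) by adding the two chords $\{0,\,x_1+x_2\}$ and $\{x_1,\,x_1+x_2+x_3\}$ (vertex labels taken modulo $n$), and assume these chords are distinct and are not edges of the cycle, so that $G$ is a simple hamiltonian graph with $n$ vertices and $m=n+2$ edges (a graph of "type A" with vector of c-path lengths $(x_1,x_2,x_3,x_4)$). Then the coefficients $N_{m-2}$ and $N_{m-3}=\tau$ (the number of spanning trees) of its reliability polynomial are $$N_{m-2}=1+2n+\sum_{1\leq i<j\leq 4}x_ix_j,$$ $$\tau=n+(x_1+x_2)(x_3+x_4)+(x_1+x_4)(x_2+x_3)+\sum_{1\leq i<j<k\leq 4}x_ix_jx_k.$$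
   Context: For a connected graph $G=(V,E)$ with $m$ edges, the reliability polynomial is $\mathrm{Rel}(G,p)=\sum_{i=0}^m N_i p^i(1-p)^{m-i}$, where $N_i$ is the number of subsets $N\subseteq E$ with $|N|=i$ such that $(V,N)$ is connected. In a type A graph as described, the two chords cross, and their four endpoints split the hamiltonian cycle into four consecutive paths of lengths $x_1,x_2,x_3,x_4$ (a length may be $0$ when the chords share an endpoint). -}

module Defs where

open import Data.Nat using (ℕ; zero; suc; _+_; NonZero)
open import Data.Nat.DivMod using (_mod_)
open import Data.Fin using (Fin; zero; suc; splitAt; toℕ)
open import Data.Fin.Subset using (Subset; _∈_; ∣_∣)
open import Data.Product using (_×_; _,_; ∃)
open import Data.Sum using (_⊎_; inj₁; inj₂)
open import Data.List using (List; length)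
open import Data.List.Relation.Unary.Unique.Propositional using (Unique)
import Data.List.Membership.Propositional as LM
open import Relation.Binary.PropositionalEquality using (_≡_)
open import Relation.Binary.Construct.Closure.ReflexiveTransitive using (Star)

vtx : (n : ℕ) .{{_ : NonZero n}} → ℕ → Fin n
vtx n k = k mod n

-- An edge given by its two endpoints (as an unordered pair).
Edge : ℕ → Set
Edge n = Fin n × Fin n

SameEdge : ∀ {n} → Edge n → Edge n → Set
SameEdge (a , b) (c , d) = (a ≡ c × b ≡ d) ⊎ (a ≡ d × b ≡ c)

cycleEdge : (n : ℕ) .{{_ : NonZero n}} → Fin n → Edge n
cycleEdge n i = vtx n (toℕ i) , vtx n (suc (toℕ i))

chord1 : (n : ℕ) .{{_ : NonZero n}} → ℕ → ℕ → ℕ → Edge n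
chord1 n x₁ x₂ x₃ = vtx n 0 , vtx n (x₁ + x₂)

chord2 : (n : ℕ) .{{_ : NonZero n}} → ℕ → ℕ → ℕ → Edge n
chord2 n x₁ x₂ x₃ = vtx n x₁ , vtx n (x₁ + x₂ + x₃)

ends : (n : ℕ) .{{_ : NonZero n}} → ℕ → ℕ → ℕ → Fin (n + 2) → Edge n
ends n x₁ x₂ x₃ e with splitAt n e
... | inj₁ i = cycleEdge n i
... | inj₂ zero = chord1 n x₁ x₂ x₃
... | inj₂ (suc _) = chord2 n x₁ x₂ x₃

Adj : ∀ {n m} → (Fin m → Edge n) → Subset m → Fin n → Fin n → Set
Adj {n} {m} ed S u v = ∃ λ (e : Fin m) → e ∈ S × SameEdge (ed e) (u , v)

Connected : ∀ {n m} → (Fin m → Edge n) → Subset m → Set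
Connected ed S = ∀ u v → Star (Adj ed S) u v

NumberOf : ∀ {m} → (Subset m → Set) → ℕ → Set
NumberOf {m} P k =
  ∃ λ (L : List (Subset m)) →
    Unique L × length L ≡ k × (∀ S → (S LM.∈ L → P S) × (P S → S LM.∈ L))

Ncoeff≡ : ∀ {n m} → (Fin m → Edge n) → ℕ → ℕ → Set
Ncoeff≡ ed i k = NumberOf (λ S → ∣ S ∣ ≡ i × Connected ed S) k

module Submission where

-- Number the edges so that the four c-paths and the two chords form six consecutive parts
-- of sizes x₁, x₂, x₃, x₄, 1, 1, and describe a spanning subgraph by its increasing list of
-- removed edges. Removing two edges of one c-path cuts off the vertices between them, so in a
-- connected spanning subgraph the removed edges lie in distinct parts. Contracting each part
-- to a single edge turns the graph into K₄, and the subgraph is connected exactly when the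
-- contracted edges that survive still connect K₄: every vertex reaches an end of its c-path
-- inside an intact stretch of the cycle. K₄ survives the loss of any two edges, and loses
-- connectivity after three exactly when they form a vertex star, whose three removed edges
-- again cut off a stretch of the cycle. Hence N_{m-2} is the sum of the products of two
-- distinct part sizes, and N_{m-3} that of three distinct part sizes minus the four stars.

open import Defs
open import Data.Bool using (true; false; not)
open import Data.Empty using (⊥; ⊥-elim)
open import Data.Fin using (Fin; zero; suc; toℕ; fromℕ<; _↑ˡ_; _↑ʳ_; splitAt)
open import Data.Fin.Properties
  using (toℕ-fromℕ<; fromℕ<-toℕ; toℕ-injective; toℕ<n; toℕ-↑ˡ; toℕ-↑ʳ;
         splitAt-↑ˡ; splitAt-↑ʳ; splitAt⁻¹-↑ˡ; splitAt⁻¹-↑ʳ)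
open import Data.Fin.Subset using (Subset; ∣_∣) renaming (_∈_ to _∈ₛ_)
open import Data.List using (List; []; _∷_; length; _++_; map; filter; foldr; cartesianProductWith)
open import Data.List.Membership.Propositional using (_∈_; _∉_; find; lose)
open import Data.List.Membership.Propositional.Properties
  using (∈-map⁺; ∈-map⁻; ∈-++⁺ˡ; ∈-++⁺ʳ; ∈-++⁻; ∈-filter⁺; ∈-filter⁻)
open import Data.List.Properties using (length-++; length-map; ∷-injective; ≡-dec; map-∘; map-id-local)
open import Data.List.Relation.Binary.Pointwise using (Pointwise; []; _∷_; Pointwise-length)
open import Data.List.Relation.Unary.All as All using (All; []; _∷_)
import Data.List.Relation.Unary.All.Properties as All
open import Data.List.Relation.Unary.AllPairs as AllPairs using (AllPairs; []; _∷_)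
open import Data.List.Relation.Unary.Any using (here; there; satisfied; any?)
import Data.List.Relation.Unary.Any.Properties as Any
open import Data.List.Relation.Unary.Unique.Propositional using (Unique)
import Data.List.Relation.Unary.Unique.Propositional.Properties as Unique
open import Data.Nat
open import Data.Nat.DivMod using (m<n⇒m%n≡m; n%n≡0)
open import Data.Nat.ListAction using (sum; product)
open import Data.Nat.Properties
open import Data.Nat.Solver using (module +-*-Solver)
open +-*-Solver using (Polynomial; solve; _:=_; _:+_; _:*_; con)
open import Data.List.Membership.DecPropositional _≟_ using (_∈?_; _∉?_)
open import Data.List.Membership.DecPropositional (≡-dec _≟_) using () renaming (_∈?_ to _∈ˡ?_)
open import Data.Product using (_×_; _,_; proj₁; proj₂; ∃)
open import Data.Sum using (_⊎_; inj₁; inj₂; [_,_]′)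
open import Data.Vec using ([]; _∷_; lookup)
open import Data.Vec.Properties using (lookup⇒[]=; []=⇒lookup)
open import Function using (_∘_; id)
open import Relation.Binary.Construct.Closure.ReflexiveTransitive as Star using (Star; ε; _◅_; _◅◅_)
open import Relation.Binary.Definitions using (Symmetric; Transitive; tri<; tri≈; tri>)
open import Relation.Binary.PropositionalEquality
open import Relation.Nullary using (¬_; yes; no; does)
open import Relation.Nullary.Decidable as Dec
  using (dec-true; dec-false; from-yes; _⊎-dec_; _×-dec_; True; toWitness)
open import Relation.Unary using (Decidable)

Increasing : List ℕ → Set
Increasing = AllPairs _<_

Increasing-≡ : ∀ {xs ys} → Increasing xs → Increasing ys →
               (∀ {k} → k ∈ xs → k ∈ ys) → (∀ {k} → k ∈ ys → k ∈ xs) → xs ≡ ys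
Increasing-≡ {[]} {[]} _ _ _ _ = refl
Increasing-≡ {[]} {y ∷ ys} _ _ _ ys⊆xs with () ← ys⊆xs (here refl)
Increasing-≡ {x ∷ xs} {[]} _ _ xs⊆ys _ with () ← xs⊆ys (here refl)
Increasing-≡ {x ∷ xs} {y ∷ ys} (x< ∷ ↑xs) (y< ∷ ↑ys) xs⊆ys ys⊆xs =
  cong₂ _∷_ x≡y (Increasing-≡ ↑xs ↑ys tail⊆ tail⊇)
  where
  x≡y : x ≡ y
  x≡y with xs⊆ys (here refl) | ys⊆xs (here refl)
  ... | here x≡y | _         = x≡y
  ... | there _  | here y≡x  = sym y≡x
  ... | there y∈ | there x∈  = ⊥-elim (<-asym (All.lookup y< y∈) (All.lookup x< x∈))
  tail⊆ : ∀ {k} → k ∈ xs → k ∈ ys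
  tail⊆ k∈ with xs⊆ys (there k∈)
  ... | here refl = ⊥-elim (<-irrefl x≡y (All.lookup x< k∈))
  ... | there k∈' = k∈'
  tail⊇ : ∀ {k} → k ∈ ys → k ∈ xs
  tail⊇ k∈ with ys⊆xs (there k∈)
  ... | here refl = ⊥-elim (<-irrefl (sym x≡y) (All.lookup y< k∈))
  ... | there k∈' = k∈'

withoutFrom : (m o : ℕ) → List ℕ → Subset m
withoutFrom zero    o R = []
withoutFrom (suc m) o R = not (does (o ∈? R)) ∷ withoutFrom m (suc o) R

without : (m : ℕ) → List ℕ → Subset m
without m = withoutFrom m 0

missingFrom : ∀ {m} → ℕ → Subset m → List ℕ
missingFrom o []          = []
missingFrom o (true ∷ S)  = missingFrom (suc o) S
missingFrom o (false ∷ S) = o ∷ missingFrom (suc o) S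

missing : ∀ {m} → Subset m → List ℕ
missing = missingFrom 0

lookup-withoutFrom : ∀ m o R (e : Fin m) → lookup (withoutFrom m o R) e ≡ not (does ((o + toℕ e) ∈? R))
lookup-withoutFrom (suc m) o R zero    rewrite +-identityʳ o = refl
lookup-withoutFrom (suc m) o R (suc e) rewrite +-suc o (toℕ e) = lookup-withoutFrom m (suc o) R e

∈-without⁺ : ∀ {m R} (e : Fin m) → toℕ e ∉ R → e ∈ₛ without m R
∈-without⁺ {m} {R} e e∉R =
  lookup⇒[]= e _ (trans (lookup-withoutFrom m 0 R e) (cong not (dec-false (toℕ e ∈? R) e∉R)))

∈-without⁻ : ∀ {m R} (e : Fin m) → e ∈ₛ without m R → toℕ e ∉ R
∈-without⁻ {m} {R} e e∈S e∈R
  with () ← trans (sym ([]=⇒lookup e∈S)) (trans (lookup-withoutFrom m 0 R e) (cong not (dec-true (toℕ e ∈? R) e∈R)))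

missingFrom-bounds : ∀ {m} o (S : Subset m) {k} → k ∈ missingFrom o S → o ≤ k × k < o + m
missingFrom-bounds {suc m} o (true ∷ S) k∈ = shift (missingFrom-bounds (suc o) S k∈)
  where shift : ∀ {k} → suc o ≤ k × k < suc o + m → o ≤ k × k < o + suc m
        shift {k} (o<k , k<) = <⇒≤ o<k , subst (k <_) (sym (+-suc o m)) k<
missingFrom-bounds {suc m} o (false ∷ S) (here refl) = ≤-refl , m<m+n o z<s
missingFrom-bounds {suc m} o (false ∷ S) {k} (there k∈)
  with o<k , k< ← missingFrom-bounds (suc o) S k∈ = <⇒≤ o<k , subst (k <_) (sym (+-suc o m)) k<

missingFrom-increasing : ∀ {m} o (S : Subset m) → Increasing (missingFrom o S)
missingFrom-increasing o []          = []
missingFrom-increasing o (true ∷ S)  = missingFrom-increasing (suc o) S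
missingFrom-increasing o (false ∷ S) =
  All.tabulate (λ k∈ → proj₁ (missingFrom-bounds (suc o) S k∈)) ∷ missingFrom-increasing (suc o) S

∣S∣+∣missingFrom∣≡m : ∀ {m} o (S : Subset m) → ∣ S ∣ + length (missingFrom o S) ≡ m
∣S∣+∣missingFrom∣≡m o []          = refl
∣S∣+∣missingFrom∣≡m o (true ∷ S)  = cong suc (∣S∣+∣missingFrom∣≡m (suc o) S)
∣S∣+∣missingFrom∣≡m o (false ∷ S) = trans (+-suc _ _) (cong suc (∣S∣+∣missingFrom∣≡m (suc o) S))

withoutFrom-∷-below : ∀ m {o k} R → k < o → withoutFrom m o (k ∷ R) ≡ withoutFrom m o R
withoutFrom-∷-below zero    R k<o = refl
withoutFrom-∷-below (suc m) {o} {k} R k<o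
  rewrite dec-false (o ≟ k) (>⇒≢ k<o) = cong (_ ∷_) (withoutFrom-∷-below m R (m<n⇒m<1+n k<o))

withoutFrom-missingFrom : ∀ {m} o (S : Subset m) → withoutFrom m o (missingFrom o S) ≡ S
withoutFrom-missingFrom o [] = refl
withoutFrom-missingFrom o (true ∷ S) = cong₂ _∷_ o∉ (withoutFrom-missingFrom (suc o) S)
  where o∉ = cong not (dec-false (o ∈? _) (λ o∈ → <-irrefl refl (proj₁ (missingFrom-bounds (suc o) S o∈))))
withoutFrom-missingFrom {suc m} o (false ∷ S) rewrite dec-true (o ≟ o) refl =
  cong (false ∷_) (trans (withoutFrom-∷-below m _ ≤-refl) (withoutFrom-missingFrom (suc o) S))

without-missing : ∀ {m} (S : Subset m) → without m (missing S) ≡ S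
without-missing = withoutFrom-missingFrom 0

missingFrom-withoutFrom⁻ : ∀ m o R {k} → k ∈ missingFrom o (withoutFrom m o R) → k ∈ R
missingFrom-withoutFrom⁻ (suc m) o R k∈ with o ∈? R
missingFrom-withoutFrom⁻ (suc m) o R (here refl) | yes o∈R = o∈R
missingFrom-withoutFrom⁻ (suc m) o R (there k∈)  | yes _   = missingFrom-withoutFrom⁻ m (suc o) R k∈
missingFrom-withoutFrom⁻ (suc m) o R k∈          | no _    = missingFrom-withoutFrom⁻ m (suc o) R k∈

missingFrom-withoutFrom⁺ : ∀ m o R {k} → o ≤ k → k < o + m → k ∈ R → k ∈ missingFrom o (withoutFrom m o R)
missingFrom-withoutFrom⁺ zero    o R {k} o≤k k< _ =
  ⊥-elim (<⇒≱ (subst (k <_) (+-identityʳ o) k<) o≤k)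
missingFrom-withoutFrom⁺ (suc m) o R {k} o≤k k< k∈R with o ∈? R | o ≟ k
... | yes _   | yes refl = here refl
... | no o∉R  | yes refl = ⊥-elim (o∉R k∈R)
... | yes _   | no o≢k   = there (missingFrom-withoutFrom⁺ m (suc o) R (≤∧≢⇒< o≤k o≢k) (subst (k <_) (+-suc o m) k<) k∈R)
... | no _    | no o≢k   = missingFrom-withoutFrom⁺ m (suc o) R (≤∧≢⇒< o≤k o≢k) (subst (k <_) (+-suc o m) k<) k∈R

missing-without : ∀ m R → Increasing R → All (_< m) R → missing (without m R) ≡ R
missing-without m R ↑R R<m = Increasing-≡ (missingFrom-increasing 0 (without m R)) ↑R
  (missingFrom-withoutFrom⁻ m 0 R) (λ k∈ → missingFrom-withoutFrom⁺ m 0 R z≤n (All.lookup R<m k∈) k∈)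

interval : ℕ → ℕ → List ℕ
interval s zero    = []
interval s (suc d) = s ∷ interval (suc s) d

length-interval : ∀ s d → length (interval s d) ≡ d
length-interval s zero    = refl
length-interval s (suc d) = cong suc (length-interval (suc s) d)

∈-interval⁻ : ∀ {s d k} → k ∈ interval s d → s ≤ k × k < s + d
∈-interval⁻ {s} {suc d} (here refl) = ≤-refl , m<m+n s z<s
∈-interval⁻ {s} {suc d} {k} (there k∈)
  with s<k , k< ← ∈-interval⁻ k∈ = <⇒≤ s<k , subst (k <_) (sym (+-suc s d)) k<

∈-interval⁺ : ∀ {s d k} → s ≤ k → k < s + d → k ∈ interval s d
∈-interval⁺ {s} {zero}  {k} s≤k k< = ⊥-elim (<-irrefl refl (≤-<-trans s≤k (subst (k <_) (+-identityʳ s) k<)))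
∈-interval⁺ {s} {suc d} {k} s≤k k< with s ≟ k
... | yes refl = here refl
... | no s≢k   = there (∈-interval⁺ (≤∧≢⇒< s≤k s≢k) (subst (k <_) (+-suc s d) k<))

interval-increasing : ∀ s d → Increasing (interval s d)
interval-increasing s zero    = []
interval-increasing s (suc d) = All.tabulate (λ k∈ → proj₁ (∈-interval⁻ k∈)) ∷ interval-increasing (suc s) d

combinations : ℕ → List ℕ → List (List ℕ)
combinations zero    xs       = [] ∷ []
combinations (suc k) []       = []
combinations (suc k) (x ∷ xs) = map (x ∷_) (combinations k xs) ++ combinations (suc k) xs

∈-tail : ∀ {x xs k} → k ∈ x ∷ xs → x < k → k ∈ xs
∈-tail (here refl) x<k = ⊥-elim (<-irrefl refl x<k)
∈-tail (there k∈)  _   = k∈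

∈-combinations : ∀ {xs K} → Increasing xs → Increasing K → (∀ {k} → k ∈ K → k ∈ xs) →
                 K ∈ combinations (length K) xs
∈-combinations {K = []} _ _ _ = here refl
∈-combinations {[]}     {y ∷ K} _ _ K⊆ with () ← K⊆ (here refl)
∈-combinations {x ∷ xs} {y ∷ K} (x< ∷ ↑xs) (y< ∷ ↑K) K⊆ with K⊆ (here refl)
... | here refl =
  ∈-++⁺ˡ (∈-map⁺ (x ∷_)
    (∈-combinations ↑xs ↑K (λ k∈ → ∈-tail (K⊆ (there k∈)) (All.lookup y< k∈))))
... | there y∈ = ∈-++⁺ʳ _ (∈-combinations ↑xs (y< ∷ ↑K) (λ k∈ → ∈-tail (K⊆ k∈) (x<K k∈)))
  where
  x<K : ∀ {k} → k ∈ y ∷ K → x < k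
  x<K (here refl) = All.lookup x< y∈
  x<K (there k∈)  = <-trans (All.lookup x< y∈) (All.lookup y< k∈)

∈-combinations⁻ : ∀ {k xs K} → Increasing xs → K ∈ combinations k xs →
                  Increasing K × length K ≡ k × (∀ {x} → x ∈ K → x ∈ xs)
∈-combinations⁻ {zero}           _          (here refl) = [] , refl , λ ()
∈-combinations⁻ {suc k} {x ∷ xs} (x< ∷ ↑xs) K∈ with ∈-++⁻ (map (x ∷_) (combinations k xs)) K∈
... | inj₁ K∈ˡ with K , K∈' , refl ← ∈-map⁻ (x ∷_) K∈ˡ
                with ↑K , len , K⊆ ← ∈-combinations⁻ {k} ↑xs K∈' =
  All.tabulate (All.lookup x< ∘ K⊆) ∷ ↑K , cong suc len ,
  λ { (here refl) → here refl ; (there y∈) → there (K⊆ y∈) }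
... | inj₂ K∈ʳ with ↑K , len , K⊆ ← ∈-combinations⁻ ↑xs K∈ʳ = ↑K , len , there ∘ K⊆

combinations-unique : ∀ k {xs} → Increasing xs → Unique (combinations k xs)
combinations-unique zero    _ = [] ∷ []
combinations-unique (suc k) {[]} _ = []
combinations-unique (suc k) {x ∷ xs} ↑xs@(x< ∷ ↑xs') =
  Unique.++⁺ (Unique.map⁺ (proj₂ ∘ ∷-injective) (combinations-unique k ↑xs'))
             (combinations-unique (suc k) ↑xs') disjoint
  where
  disjoint : ∀ {K} → K ∈ map (x ∷_) (combinations k xs) × K ∈ combinations (suc k) xs → ⊥
  disjoint (K∈ˡ , K∈ʳ) with _ , _ , refl ← ∈-map⁻ (x ∷_) K∈ˡ =
    <-irrefl refl (All.lookup x< (proj₂ (proj₂ (∈-combinations⁻ {suc k} ↑xs' K∈ʳ)) (here refl)))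

length-cartesianProductWith : ∀ {A B C : Set} (f : A → B → C) xs ys →
                              length (cartesianProductWith f xs ys) ≡ length xs * length ys
length-cartesianProductWith f []       ys = refl
length-cartesianProductWith f (x ∷ xs) ys =
  trans (length-++ (map (f x) ys)) (cong₂ _+_ (length-map (f x) ys) (length-cartesianProductWith f xs ys))

weightSum : (ℕ → ℕ) → List (List ℕ) → ℕ
weightSum w Ks = sum (map (λ K → product (map w K)) Ks)

module Parts (w : ℕ → ℕ) where

  start : ℕ → ℕ
  start zero    = 0
  start (suc L) = start L + w L

  _∈ᵖ_ : ℕ → ℕ → Set
  r ∈ᵖ L = start L ≤ r × r < start (suc L)

  part : ℕ → List ℕ
  part L = interval (start L) (w L)

  start-≤-+ : ∀ L d → start L ≤ start (d + L)
  start-≤-+ L zero    = ≤-refl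
  start-≤-+ L (suc d) = ≤-trans (start-≤-+ L d) (m≤m+n _ _)

  start-mono : ∀ {L L'} → L ≤ L' → start L ≤ start L'
  start-mono {L} L≤L' = subst (λ z → start L ≤ start z) (m∸n+n≡m L≤L') (start-≤-+ L (_ ∸ L))

  start-≤ : ∀ L L' → {True (L ≤? L')} → start L ≤ start L'
  start-≤ L L' {L≤L'} = start-mono (toWitness L≤L')

  locate : ∀ K {r} → r < start K → ∃ λ L → L < K × r ∈ᵖ L
  locate (suc K) {r} r< with r <? start K
  ... | yes r<' with L , L<K , r∈L ← locate K r<' = L , m<n⇒m<1+n L<K , r∈L
  ... | no r≮   = K , ≤-refl , ≮⇒≥ r≮ , r<

  ∈ᵖ-mono : ∀ {r r' L L'} → r ∈ᵖ L → r' ∈ᵖ L' → r ≤ r' → L ≤ L'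
  ∈ᵖ-mono {L = L} {L'} (L≤r , _) (_ , r'<) r≤r' with L ≤? L'
  ... | yes L≤L' = L≤L'
  ... | no L≰L'  = ⊥-elim (<⇒≱ r'< (≤-trans (start-mono (≰⇒> L≰L')) (≤-trans L≤r r≤r')))

  ∈ᵖ-unique : ∀ {r L L'} → r ∈ᵖ L → r ∈ᵖ L' → L ≡ L'
  ∈ᵖ-unique r∈L r∈L' = ≤-antisym (∈ᵖ-mono r∈L r∈L' ≤-refl) (∈ᵖ-mono r∈L' r∈L ≤-refl)

  choices : List ℕ → List (List ℕ)
  choices []      = [] ∷ []
  choices (L ∷ K) = cartesianProductWith _∷_ (part L) (choices K)

  ∈-choices⁺ : ∀ {R K} → Pointwise _∈ᵖ_ R K → R ∈ choices K
  ∈-choices⁺ []            = here refl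
  ∈-choices⁺ (r∈L ∷ R∈K) =
    Any.cartesianProductWith⁺ _∷_ (cong₂ _∷_) (∈-interval⁺ (proj₁ r∈L) (proj₂ r∈L)) (∈-choices⁺ R∈K)

  ∈-choices⁻ : ∀ {R} K → R ∈ choices K → Pointwise _∈ᵖ_ R K
  ∈-choices⁻ {[]}    []      _         = []
  ∈-choices⁻ {[]}    (L ∷ K) []∈
    with () ← proj₂ (satisfied (proj₁
      (Any.cartesianProductWith⁻ _∷_ {P = λ _ → ⊥} {Q = λ _ → ⊥} (λ ()) (part L) (choices K) []∈)))
  ∈-choices⁻ {_ ∷ _} []      (here ())
  ∈-choices⁻ {_ ∷ _} []      (there ())
  ∈-choices⁻ {r ∷ R} (L ∷ K) R∈
    with r∈L , R∈K ← Any.cartesianProductWith⁻ _∷_ ∷-injective (part L) (choices K) R∈ =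
    ∈-interval⁻ r∈L ∷ ∈-choices⁻ K R∈K

  length-choices : ∀ K → length (choices K) ≡ product (map w K)
  length-choices []      = refl
  length-choices (L ∷ K) =
    trans (length-cartesianProductWith _∷_ (part L) (choices K))
          (cong₂ _*_ (length-interval (start L) (w L)) (length-choices K))

  choices-unique : ∀ K → Unique (choices K)
  choices-unique []      = [] ∷ []
  choices-unique (L ∷ K) =
    Unique.cartesianProductWith⁺ _∷_ ∷-injective
      (AllPairs.map <⇒≢ (interval-increasing (start L) (w L))) (choices-unique K)

  Labelled : List ℕ → List ℕ → Set
  Labelled = Pointwise _∈ᵖ_

  labelled-∈ : ∀ {R K r} → Labelled R K → r ∈ R → ∃ λ L → L ∈ K × r ∈ᵖ L
  labelled-∈ (r∈L ∷ _)   (here refl) = _ , here refl , r∈L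
  labelled-∈ (_ ∷ R∼K) (there r∈)
    with L , L∈ , r∈L ← labelled-∈ R∼K r∈ = L , there L∈ , r∈L

  labels-unique : ∀ {R K K'} → Labelled R K → Labelled R K' → K ≡ K'
  labels-unique []            []              = refl
  labels-unique (r∈L ∷ R∼K) (r∈L' ∷ R∼K') = cong₂ _∷_ (∈ᵖ-unique r∈L r∈L') (labels-unique R∼K R∼K')

  labelled-increasing : ∀ {R K} → Increasing K → Labelled R K → Increasing R
  labelled-increasing []           []            = []
  labelled-increasing {r ∷ R} (L< ∷ ↑K) (r∈L ∷ R∼K) = All.tabulate r<R ∷ labelled-increasing ↑K R∼K
    where
    r<R : ∀ {r'} → r' ∈ R → r < r'
    r<R r'∈ with L' , L'∈ , r'∈L' ← labelled-∈ R∼K r'∈ with _ <? _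
    ... | yes r<r' = r<r'
    ... | no r≮r'  = ⊥-elim (<⇒≱ (All.lookup L< L'∈) (∈ᵖ-mono r'∈L' r∈L (≮⇒≥ r≮r')))

  labelled-bounded : ∀ {R K J} → All (_< J) K → Labelled R K → All (_< start J) R
  labelled-bounded []          []            = []
  labelled-bounded (L<J ∷ K<J) (r∈L ∷ R∼K) = <-≤-trans (proj₂ r∈L) (start-mono L<J) ∷ labelled-bounded K<J R∼K

  labelled-avoids : ∀ {R K r L} → Labelled R K → L ∉ K → r ∈ R → ¬ r ∈ᵖ L
  labelled-avoids R∼K L∉K r∈ r∈L
    with L' , L'∈ , r∈L' ← labelled-∈ R∼K r∈ = L∉K (subst (_∈ _) (∈ᵖ-unique r∈L' r∈L) L'∈)

  labelled-at-most-one : ∀ {R K r r' L} → Increasing K → Labelled R K → r ∈ R → r' ∈ R →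
                         r ∈ᵖ L → r' ∈ᵖ L → r ≡ r'
  labelled-at-most-one _ (_ ∷ _) (here refl) (here refl) _ _ = refl
  labelled-at-most-one (L< ∷ _) (r∈L₀ ∷ R∼K) (here refl) (there r'∈) r∈L r'∈L
    with L' , L'∈ , r'∈L' ← labelled-∈ R∼K r'∈ =
    ⊥-elim (<-irrefl (trans (∈ᵖ-unique r∈L₀ r∈L) (∈ᵖ-unique r'∈L r'∈L')) (All.lookup L< L'∈))
  labelled-at-most-one (L< ∷ _) (r'∈L₀ ∷ R∼K) (there r∈) (here refl) r∈L r'∈L
    with L' , L'∈ , r∈L' ← labelled-∈ R∼K r∈ =
    ⊥-elim (<-irrefl (trans (∈ᵖ-unique r'∈L₀ r'∈L) (∈ᵖ-unique r∈L r∈L')) (All.lookup L< L'∈))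
  labelled-at-most-one (_ ∷ ↑K) (_ ∷ R∼K) (there r∈) (there r'∈) r∈L r'∈L =
    labelled-at-most-one ↑K R∼K r∈ r'∈ r∈L r'∈L

  labelling : ∀ {J} R → All (_< start J) R → ∃ λ K → Labelled R K × All (_< J) K
  labelling []      []             = [] , [] , []
  labelling {J} (r ∷ R) (r< ∷ R<)
    with L , L<J , r∈L ← locate J r< | K , R∼K , K<J ← labelling R R< = L ∷ K , r∈L ∷ R∼K , L<J ∷ K<J

  SharedPart : List ℕ → Set
  SharedPart R = ∃ λ L → ∃ λ r → ∃ λ r' → r < r' × r ∈ R × r' ∈ R × r ∈ᵖ L × r' ∈ᵖ L

  labels-increasing-or-shared : ∀ {R K} → Increasing R → Labelled R K → Increasing K ⊎ SharedPart R
  labels-increasing-or-shared [] [] = inj₁ []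
  labels-increasing-or-shared (r< ∷ ↑R) (r∈L ∷ R∼K) with labels-increasing-or-shared ↑R R∼K
  ... | inj₂ (L , r , r' , r<r' , r∈ , r'∈ , shared) = inj₂ (L , r , r' , r<r' , there r∈ , there r'∈ , shared)
  labels-increasing-or-shared (r< ∷ ↑R) (r∈L ∷ [])            | inj₁ [] = inj₁ ([] ∷ [])
  labels-increasing-or-shared {r ∷ r' ∷ _} {L ∷ L' ∷ _} (r< ∷ ↑R) (r∈L ∷ r'∈L' ∷ R∼K) | inj₁ ↑K@(L'< ∷ _)
    with m≤n⇒m<n∨m≡n (∈ᵖ-mono r∈L r'∈L' (<⇒≤ (All.lookup r< (here refl))))
  ... | inj₁ L<L' = inj₁ ((L<L' ∷ All.map (<-trans L<L') L'<) ∷ ↑K)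
  ... | inj₂ refl = inj₂ (L , r , r' , All.lookup r< (here refl) , here refl , there (here refl) , r∈L , r'∈L')

  choicesOf : List (List ℕ) → List (List ℕ)
  choicesOf []       = []
  choicesOf (K ∷ Ks) = choices K ++ choicesOf Ks

  ∈-choicesOf⁺ : ∀ {R K Ks} → K ∈ Ks → Labelled R K → R ∈ choicesOf Ks
  ∈-choicesOf⁺ {Ks = K ∷ Ks} (here refl) R∼K = ∈-++⁺ˡ (∈-choices⁺ R∼K)
  ∈-choicesOf⁺ {Ks = K ∷ Ks} (there K∈)  R∼K = ∈-++⁺ʳ (choices K) (∈-choicesOf⁺ K∈ R∼K)

  ∈-choicesOf⁻ : ∀ {R} Ks → R ∈ choicesOf Ks → ∃ λ K → K ∈ Ks × Labelled R K
  ∈-choicesOf⁻ (K ∷ Ks) R∈ with ∈-++⁻ (choices K) R∈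
  ... | inj₁ R∈K  = K , here refl , ∈-choices⁻ K R∈K
  ... | inj₂ R∈Ks with K' , K'∈ , R∼K' ← ∈-choicesOf⁻ Ks R∈Ks = K' , there K'∈ , R∼K'

  length-choicesOf : ∀ Ks → length (choicesOf Ks) ≡ weightSum w Ks
  length-choicesOf []       = refl
  length-choicesOf (K ∷ Ks) =
    trans (length-++ (choices K)) (cong₂ _+_ (length-choices K) (length-choicesOf Ks))

  choicesOf-unique : ∀ {Ks} → Unique Ks → Unique (choicesOf Ks)
  choicesOf-unique {[]}     _          = []
  choicesOf-unique {K ∷ Ks} (K∉ ∷ !Ks) = Unique.++⁺ (choices-unique K) (choicesOf-unique !Ks) disjoint
    where
    disjoint : ∀ {R} → R ∈ choices K × R ∈ choicesOf Ks → ⊥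
    disjoint (R∈K , R∈Ks) with K' , K'∈ , R∼K' ← ∈-choicesOf⁻ Ks R∈Ks =
      All.lookup K∉ K'∈ (labels-unique (∈-choices⁻ K R∈K) R∼K')

-- Contracting every part to a single edge turns the type A graph into K₄ on the branch
-- points 0, 1, 2, 3; the hamiltonian cycle is 0 1 2 3 and the chords are 02 and 13.
skeletonEdge : ℕ → ℕ × ℕ
skeletonEdge 0 = 0 , 1
skeletonEdge 1 = 1 , 2
skeletonEdge 2 = 2 , 3
skeletonEdge 3 = 3 , 0
skeletonEdge 4 = 0 , 2
skeletonEdge _ = 1 , 3

grow : List (ℕ × ℕ) → List ℕ → List ℕ
grow es Z = Z ++ map proj₂ (filter (λ e → proj₁ e ∈? Z) es) ++ map proj₁ (filter (λ e → proj₂ e ∈? Z) es)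

reachableFrom0 : List (ℕ × ℕ) → List ℕ
reachableFrom0 es = grow es (grow es (grow es (0 ∷ [])))

keptParts : List ℕ → List ℕ
keptParts K = filter (_∉? K) (interval 0 6)

-- A record rather than a synonym: for a symbolic K, with-abstraction would otherwise
-- normalise the exponentially large reachability computation.
record SkeletonConnected (K : List ℕ) : Set where
  constructor reaching
  field reaches : All (_∈ reachableFrom0 (map skeletonEdge (keptParts K))) (interval 0 4)

SkeletonConnected? : Decidable SkeletonConnected
SkeletonConnected? K = Dec.map′ reaching SkeletonConnected.reaches (All.all? (_∈? _) (interval 0 4))

-- The four vertex stars of K₄ are exactly its 3-edge cuts.
stars : List (List ℕ)
stars = (0 ∷ 3 ∷ 4 ∷ []) ∷ (0 ∷ 1 ∷ 5 ∷ []) ∷ (1 ∷ 2 ∷ 4 ∷ []) ∷ (2 ∷ 3 ∷ 5 ∷ []) ∷ []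

goodLabels : ℕ → List (List ℕ)
goodLabels d = filter SkeletonConnected? (combinations d (interval 0 6))

Classified : ℕ → Set
Classified d = All (λ K → SkeletonConnected K ⊎ K ∈ stars) (combinations d (interval 0 6))

classified-2 : Classified 2
classified-2 = from-yes (All.all? (λ K → SkeletonConnected? K ⊎-dec (K ∈ˡ? stars)) (combinations 2 (interval 0 6)))

classified-3 : Classified 3
classified-3 = from-yes (All.all? (λ K → SkeletonConnected? K ⊎-dec (K ∈ˡ? stars)) (combinations 3 (interval 0 6)))

module Reachability {V : Set} {_~_ : V → V → Set} (~-sym : Symmetric _~_) (~-trans : Transitive _~_)
                    (b : ℕ → V) {es : List (ℕ × ℕ)} (edges : All (λ (u , v) → b u ~ b v) es) where

  Reaches0 : ℕ → Set
  Reaches0 j = b j ~ b 0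

  grow-sound : ∀ {Z} → All Reaches0 Z → All Reaches0 (grow es Z)
  grow-sound {Z} Z↝0 = All.++⁺ Z↝0 (All.++⁺ (All.tabulate forward) (All.tabulate backward))
    where
    forward : ∀ {j} → j ∈ map proj₂ (filter (λ e → proj₁ e ∈? Z) es) → Reaches0 j
    forward j∈ with e , e∈ , refl ← ∈-map⁻ proj₂ j∈
               with e∈es , u∈Z ← ∈-filter⁻ (λ e → proj₁ e ∈? Z) e∈ =
      ~-trans (~-sym (All.lookup edges e∈es)) (All.lookup Z↝0 u∈Z)
    backward : ∀ {j} → j ∈ map proj₁ (filter (λ e → proj₂ e ∈? Z) es) → Reaches0 j
    backward j∈ with e , e∈ , refl ← ∈-map⁻ proj₁ j∈
                with e∈es , v∈Z ← ∈-filter⁻ (λ e → proj₂ e ∈? Z) e∈ =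
      ~-trans (All.lookup edges e∈es) (All.lookup Z↝0 v∈Z)

  reachableFrom0-sound : b 0 ~ b 0 → All Reaches0 (reachableFrom0 es)
  reachableFrom0-sound refl0 = grow-sound (grow-sound (grow-sound (refl0 ∷ [])))

-- Under the edge numbering of `ends`, part L of the type A graph consists of the edge
-- indices in [start L, start (L + 1)): parts 0–3 are its c-paths, parts 4 and 5 its chords.
partSizes : {A : Set} → A → A → A → A → A → ℕ → A
partSizes x₁ x₂ x₃ x₄ chord 0 = x₁
partSizes x₁ x₂ x₃ x₄ chord 1 = x₂
partSizes x₁ x₂ x₃ x₄ chord 2 = x₃
partSizes x₁ x₂ x₃ x₄ chord 3 = x₄
partSizes x₁ x₂ x₃ x₄ chord _ = chord

-- Solver syntax built by the same recursion as `weightSum`, so that its interpretation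
-- is that weight sum by definition.
sumOfProducts : ∀ {k} → (ℕ → Polynomial k) → List (List ℕ) → Polynomial k
sumOfProducts w = foldr (λ K p → foldr (λ L q → w L :* q) (con 1) K :+ p) (con 0)

weightSum-goodLabels-2 : ∀ a b c d → weightSum (partSizes a b c d 1) (goodLabels 2) ≡
                         1 + 2 * (a + b + c + d) + (a * b + a * c + a * d + b * c + b * d + c * d)
weightSum-goodLabels-2 = solve 4 (λ a b c d →
  sumOfProducts (partSizes a b c d (con 1)) (goodLabels 2)
    := con 1 :+ con 2 :* (a :+ b :+ c :+ d) :+ (a :* b :+ a :* c :+ a :* d :+ b :* c :+ b :* d :+ c :* d)) refl

weightSum-goodLabels-3 : ∀ a b c d → weightSum (partSizes a b c d 1) (goodLabels 3) ≡
                         (a + b + c + d) + (a + b) * (c + d) + (a + d) * (b + c)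
                           + (a * b * c + a * b * d + a * c * d + b * c * d)
weightSum-goodLabels-3 = solve 4 (λ a b c d →
  sumOfProducts (partSizes a b c d (con 1)) (goodLabels 3)
    := (a :+ b :+ c :+ d) :+ (a :+ b) :* (c :+ d) :+ (a :+ d) :* (b :+ c)
         :+ (a :* b :* c :+ a :* b :* d :+ a :* c :* d :+ b :* c :* d)) refl

module TypeA (x₁ x₂ x₃ x₄ : ℕ) .{{_ : NonZero (x₁ + x₂ + x₃ + x₄)}} where

  n : ℕ
  n = x₁ + x₂ + x₃ + x₄

  partSize : ℕ → ℕ
  partSize = partSizes x₁ x₂ x₃ x₄ 1

  open Parts partSize public

  ed : Fin (n + 2) → Edge n
  ed = ends n x₁ x₂ x₃

  branch : ℕ → Fin n
  branch j = vtx n (start j)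

  toℕ-vtx : ∀ {k} → k < n → toℕ (vtx n k) ≡ k
  toℕ-vtx k<n = trans (toℕ-fromℕ< _) (m<n⇒m%n≡m k<n)

  toℕ-vtx-n : toℕ (vtx n n) ≡ 0
  toℕ-vtx-n = trans (toℕ-fromℕ< _) (n%n≡0 n)

  vtx-toℕ : (u : Fin n) → vtx n (toℕ u) ≡ u
  vtx-toℕ u = toℕ-injective (toℕ-vtx (toℕ<n u))

  vtx-n≡vtx-0 : vtx n n ≡ vtx n 0
  vtx-n≡vtx-0 = toℕ-injective (trans toℕ-vtx-n (sym (toℕ-vtx (>-nonZero⁻¹ n))))

  cycleIndex : ∀ {i} → i < n → Fin (n + 2)
  cycleIndex i<n = fromℕ< i<n ↑ˡ 2

  chord₁Index chord₂Index : Fin (n + 2)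
  chord₁Index = n ↑ʳ zero
  chord₂Index = n ↑ʳ suc zero

  toℕ-cycleIndex : ∀ {i} (i<n : i < n) → toℕ (cycleIndex i<n) ≡ i
  toℕ-cycleIndex i<n = trans (toℕ-↑ˡ (fromℕ< i<n) 2) (toℕ-fromℕ< i<n)

  toℕ-chord₁Index : toℕ chord₁Index ≡ n
  toℕ-chord₁Index = trans (toℕ-↑ʳ n (zero {1})) (+-identityʳ n)

  toℕ-chord₂Index : toℕ chord₂Index ≡ n + 1
  toℕ-chord₂Index = toℕ-↑ʳ n (suc (zero {0}))

  ed-cycleIndex : ∀ {i} (i<n : i < n) → ed (cycleIndex i<n) ≡ (vtx n i , vtx n (suc i))
  ed-cycleIndex i<n rewrite splitAt-↑ˡ n (fromℕ< i<n) 2 | toℕ-fromℕ< i<n = refl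

  ed-chord₁Index : ed chord₁Index ≡ (branch 0 , branch 2)
  ed-chord₁Index rewrite splitAt-↑ʳ n 2 zero = refl

  ed-chord₂Index : ed chord₂Index ≡ (branch 1 , branch 3)
  ed-chord₂Index rewrite splitAt-↑ʳ n 2 (suc zero) = refl

  data EdgeView : Fin (n + 2) → Set where
    cycle  : ∀ {i} (i<n : i < n) → EdgeView (cycleIndex i<n)
    chord₁ : EdgeView chord₁Index
    chord₂ : EdgeView chord₂Index

  edgeView : ∀ e → EdgeView e
  edgeView e with splitAt n e in eq
  ... | inj₁ i with refl ← splitAt⁻¹-↑ˡ eq =
    subst (λ i' → EdgeView (i' ↑ˡ 2)) (fromℕ<-toℕ i (toℕ<n i)) (cycle (toℕ<n i))
  ... | inj₂ zero       with refl ← splitAt⁻¹-↑ʳ eq = chord₁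
  ... | inj₂ (suc zero) with refl ← splitAt⁻¹-↑ʳ eq = chord₂

  ∈ᵖ-chord : ∀ {L r} → 4 ≤ L → r ∈ᵖ L → r ≡ start L
  ∈ᵖ-chord {L} {r} (s≤s (s≤s (s≤s (s≤s _)))) (L≤r , r<) =
    ≤-antisym (m<1+n⇒m≤n (subst (r <_) (+-comm (start L) 1) r<)) L≤r

  module Window (a c : ℕ) where

    Inside : Fin n → Set
    Inside v = a < toℕ v × toℕ v ≤ c

    SameSide : Fin n → Fin n → Set
    SameSide u v = (Inside u → Inside v) × (Inside v → Inside u)

    toℕ-vtx-≤n : ∀ {k} → k ≤ n → toℕ (vtx n k) ≡ k ⊎ toℕ (vtx n k) ≡ 0
    toℕ-vtx-≤n k≤n with m≤n⇒m<n∨m≡n k≤n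
    ... | inj₁ k<n  = inj₁ (toℕ-vtx k<n)
    ... | inj₂ refl = inj₂ toℕ-vtx-n

    outside-below : ∀ {k} → k ≤ a → k ≤ n → ¬ Inside (vtx n k)
    outside-below k≤a k≤n (a< , _) with toℕ-vtx-≤n k≤n
    ... | inj₁ eq = <⇒≱ (subst (a <_) eq a<) k≤a
    ... | inj₂ eq = n≮0 (subst (a <_) eq a<)

    outside-above : ∀ {k} → c < k → k ≤ n → ¬ Inside (vtx n k)
    outside-above c<k k≤n (a< , ≤c) with toℕ-vtx-≤n k≤n
    ... | inj₁ eq = <⇒≱ c<k (subst (_≤ c) eq ≤c)
    ... | inj₂ eq = n≮0 (subst (a <_) eq a<)

    inside : ∀ {k} → c < n → a < k → k ≤ c → Inside (vtx n k)
    inside c<n a<k k≤c rewrite toℕ-vtx (≤-<-trans k≤c c<n) = a<k , k≤c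

    both-inside : ∀ {u v} → Inside u → Inside v → SameSide u v
    both-inside u-in v-in = (λ _ → v-in) , (λ _ → u-in)

    both-outside : ∀ {u v} → ¬ Inside u → ¬ Inside v → SameSide u v
    both-outside u-out v-out = (λ u-in → ⊥-elim (u-out u-in)) , (λ v-in → ⊥-elim (v-out v-in))

    cycle-edge-same-side : a < c → c < n → ∀ {i} → i < n → i ≢ a → i ≢ c → SameSide (vtx n i) (vtx n (suc i))
    cycle-edge-same-side a<c c<n {i} i<n i≢a i≢c with <-cmp i a
    ... | tri< i<a _ _ = both-outside (outside-below (<⇒≤ i<a) (<⇒≤ i<n)) (outside-below i<a i<n)
    ... | tri≈ _ i≡a _ = ⊥-elim (i≢a i≡a)
    ... | tri> _ _ a<i with <-cmp i c
    ...   | tri< i<c _ _ = both-inside (inside c<n a<i (<⇒≤ i<c)) (inside c<n (m<n⇒m<1+n a<i) i<c)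
    ...   | tri≈ _ i≡c _ = ⊥-elim (i≢c i≡c)
    ...   | tri> _ _ c<i = both-outside (outside-above c<i (<⇒≤ i<n)) (outside-above (m<n⇒m<1+n c<i) i<n)

    branch-outside : ∀ {L j} → j ≤ 4 → a ∈ᵖ L → c ∈ᵖ L → ¬ Inside (branch j)
    branch-outside {L} {j} j≤4 (L≤a , _) (_ , c<) with j ≤? L
    ... | yes j≤L = outside-below (≤-trans (start-mono j≤L) L≤a) (start-mono j≤4)
    ... | no j≰L  = outside-above (<-≤-trans c< (start-mono (≰⇒> j≰L))) (start-mono j≤4)

  module Removing (R : List ℕ) where

    S : Subset (n + 2)
    S = without (n + 2) R

    _⇝_ : Fin n → Fin n → Set
    _⇝_ = Star (Adj ed S)

    Adj-sym : ∀ {u v} → Adj ed S u v → Adj ed S v u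
    Adj-sym (e , e∈S , inj₁ (u≡ , v≡)) = e , e∈S , inj₂ (u≡ , v≡)
    Adj-sym (e , e∈S , inj₂ (v≡ , u≡)) = e , e∈S , inj₁ (v≡ , u≡)

    ⇝-sym : ∀ {u v} → u ⇝ v → v ⇝ u
    ⇝-sym = Star.reverse Adj-sym

    kept-edge : ∀ {e u v} → toℕ e ∉ R → ed e ≡ (u , v) → u ⇝ v
    kept-edge {e} e∉R ed-e =
      (e , ∈-without⁺ e e∉R , subst (λ uv → SameEdge uv _) (sym ed-e) (inj₁ (refl , refl))) ◅ ε

    arc-+ : ∀ p d → p + d ≤ n → (∀ {i} → p ≤ i → i < p + d → i ∉ R) → vtx n p ⇝ vtx n (p + d)
    arc-+ p zero    _   _    rewrite +-identityʳ p = ε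
    arc-+ p (suc d) p+d≤n kept rewrite +-suc p d =
      kept-edge (subst (_∉ R) (sym (toℕ-cycleIndex p<n)) (kept ≤-refl (s≤s (m≤m+n p d)))) (ed-cycleIndex p<n)
      ◅◅ arc-+ (suc p) d p+d≤n (λ p<i i< → kept (<⇒≤ p<i) i<)
      where p<n = ≤-trans (s≤s (m≤m+n p d)) p+d≤n

    arc : ∀ {p q} → p ≤ q → q ≤ n → (∀ {i} → p ≤ i → i < q → i ∉ R) → vtx n p ⇝ vtx n q
    arc {p} p≤q q≤n kept rewrite sym (m+[n∸m]≡n p≤q) = arc-+ p _ q≤n kept

    -- Every kept edge has both ends on the same side of the window (a, c], so no walk
    -- leads from c, inside it, to 0, outside it.
    window-cut : ∀ {a c} → a < c → c < n → a ∈ R → c ∈ R →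
                 n ∈ R ⊎ Window.SameSide a c (branch 0) (branch 2) →
                 n + 1 ∈ R ⊎ Window.SameSide a c (branch 1) (branch 3) →
                 ¬ Connected ed S
    window-cut {a} {c} a<c c<n a∈R c∈R chord₁-cut chord₂-cut connected =
      outside-below z≤n z≤n
        (Star.fold (λ u v → Inside u → Inside v) (λ adj stay → stay ∘ step adj) id
          (connected (vtx n c) (vtx n 0)) (inside c<n a<c ≤-refl))
      where
      open Window a c

      along : ∀ {x y u v} → SameSide x y → SameEdge (x , y) (u , v) → Inside u → Inside v
      along (x→y , _) (inj₁ (refl , refl)) = x→y
      along (_ , y→x) (inj₂ (refl , refl)) = y→x

      across-chord : ∀ {e r x y u v} → toℕ e ≡ r → ed e ≡ (x , y) → r ∈ R ⊎ SameSide x y →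
                     e ∈ₛ S → SameEdge (ed e) (u , v) → Inside u → Inside v
      across-chord index _    (inj₁ r∈R)   e∈S _    = ⊥-elim (∈-without⁻ _ e∈S (subst (_∈ R) (sym index) r∈R))
      across-chord _     ed-e (inj₂ sides) _   same = along sides (subst (λ uv → SameEdge uv _) ed-e same)

      step : ∀ {u v} → Adj ed S u v → Inside u → Inside v
      step (e , e∈S , same) with edgeView e
      ... | cycle {i} i<n = along (cycle-edge-same-side a<c c<n i<n (λ { refl → i∉R a∈R }) (λ { refl → i∉R c∈R }))
                                  (subst (λ uv → SameEdge uv _) (ed-cycleIndex i<n) same)
        where i∉R = subst (_∉ R) (toℕ-cycleIndex i<n) (∈-without⁻ _ e∈S)
      step (e , e∈S , same) | chord₁ = across-chord toℕ-chord₁Index ed-chord₁Index chord₁-cut e∈S same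
      step (e , e∈S , same) | chord₂ = across-chord toℕ-chord₂Index ed-chord₂Index chord₂-cut e∈S same

    part-cut : ∀ {L a c} → L ≤ 3 → a ∈ᵖ L → c ∈ᵖ L → a < c → a ∈ R → c ∈ R → ¬ Connected ed S
    part-cut {L} {a} {c} L≤3 a∈L c∈L a<c a∈R c∈R =
      window-cut a<c (<-≤-trans (proj₂ c∈L) (start-mono (s≤s L≤3))) a∈R c∈R
        (inj₂ (both-outside (outside 0 z≤n) (outside 2 (s≤s (s≤s z≤n)))))
        (inj₂ (both-outside (outside 1 (s≤s z≤n)) (outside 3 (s≤s (s≤s (s≤s z≤n))))))
      where
      open Window a c
      outside : ∀ j → j ≤ 4 → ¬ Inside (branch j)
      outside j j≤4 = branch-outside {L} j≤4 a∈L c∈L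

    module _ {K : List ℕ} (R∼K : Labelled R K) where

      intact-path : ∀ {L} → L ≤ 3 → L ∉ K → branch L ⇝ branch (suc L)
      intact-path {L} L≤3 L∉K =
        arc (start-mono (n≤1+n L)) (start-mono (s≤s L≤3))
            (λ L≤i i< i∈R → labelled-avoids R∼K L∉K i∈R (L≤i , i<))

      kept-part : ∀ {L} → L < 6 → L ∉ K → branch (proj₁ (skeletonEdge L)) ⇝ branch (proj₂ (skeletonEdge L))
      kept-part {0} _ L∉K = intact-path z≤n L∉K
      kept-part {1} _ L∉K = intact-path (s≤s z≤n) L∉K
      kept-part {2} _ L∉K = intact-path (s≤s (s≤s z≤n)) L∉K
      kept-part {3} _ L∉K = subst (branch 3 ⇝_) vtx-n≡vtx-0 (intact-path (s≤s (s≤s (s≤s z≤n))) L∉K)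
      kept-part {4} _ L∉K = kept-edge (subst (_∉ R) (sym toℕ-chord₁Index) n∉R) ed-chord₁Index
        where n∉R = λ n∈R → labelled-avoids R∼K L∉K n∈R (≤-refl , m<m+n n z<s)
      kept-part {5} _ L∉K = kept-edge (subst (_∉ R) (sym toℕ-chord₂Index) n+1∉R) ed-chord₂Index
        where n+1∉R = λ n+1∈R → labelled-avoids R∼K L∉K n+1∈R (≤-refl , m<m+n (n + 1) z<s)
      kept-part {suc (suc (suc (suc (suc (suc _)))))} (s≤s (s≤s (s≤s (s≤s (s≤s (s≤s ())))))) _

      skeleton-walks : All (λ (u , v) → branch u ⇝ branch v) (map skeletonEdge (keptParts K))
      skeleton-walks = All.map⁺ (All.tabulate λ L∈ →
        let L∈6 , L∉K = ∈-filter⁻ (_∉? K) {xs = interval 0 6} L∈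
        in kept-part (proj₂ (∈-interval⁻ L∈6)) L∉K)

      branch-reaches-0 : SkeletonConnected K → ∀ j → j ≤ 4 → branch j ⇝ branch 0
      branch-reaches-0 connected j j≤4 with j ≟ 4
      ... | yes refl = subst (branch 4 ⇝_) vtx-n≡vtx-0 ε
      ... | no j≢4   = All.lookup (reachableFrom0-sound ε)
                         (All.lookup (SkeletonConnected.reaches connected) (∈-interval⁺ z≤n (≤∧≢⇒< j≤4 j≢4)))
        where open Reachability {_~_ = _⇝_} ⇝-sym _◅◅_ branch skeleton-walks

      -- The part of t contains at most one removed edge; t walks away from it to an end of
      -- its c-path.
      walk-to-0 : Increasing K → SkeletonConnected K → ∀ u → u ⇝ branch 0
      walk-to-0 ↑K connected u = subst (_⇝ branch 0) (vtx-toℕ u) (from (toℕ<n u))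
        where
        from : ∀ {t} → t < n → vtx n t ⇝ branch 0
        from {t} t<n with L , L<4 , L≤t , t< ← locate 4 t<n
                   with any? (λ r → start L ≤? r ×-dec r <? t) R
        ... | yes removed-before
          with r , r∈R , L≤r , r<t ← find removed-before =
          arc (<⇒≤ t<) (start-mono L<4) (λ t≤i i< i∈R →
            <⇒≱ r<t (subst (t ≤_) (labelled-at-most-one {L = L} ↑K R∼K i∈R r∈R
                                      (≤-trans L≤t t≤i , i<) (L≤r , <-trans r<t t<)) t≤i))
          ◅◅ branch-reaches-0 connected (suc L) L<4
        ... | no none-before =
          ⇝-sym (arc L≤t (<⇒≤ t<n) (λ L≤i i<t i∈R → none-before (lose i∈R (L≤i , i<t))))
          ◅◅ branch-reaches-0 connected L (<⇒≤ L<4)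

      connected-if-skeleton-connected : Increasing K → SkeletonConnected K → Connected ed S
      connected-if-skeleton-connected ↑K connected u v =
        walk-to-0 ↑K connected u ◅◅ ⇝-sym (walk-to-0 ↑K connected v)

    shared-part-cut : SharedPart R → ¬ Connected ed S
    shared-part-cut (L , r , r' , r<r' , r∈R , r'∈R , r∈L , r'∈L) with L ≤? 3
    ... | yes L≤3 = part-cut L≤3 r∈L r'∈L r<r' r∈R r'∈R
    ... | no L≰3  = λ _ → <⇒≢ r<r' (trans (∈ᵖ-chord (≰⇒> L≰3) r∈L) (sym (∈ᵖ-chord (≰⇒> L≰3) r'∈L)))

    star-cut : ∀ {K} → Labelled R K → K ∈ stars → ¬ Connected ed S
    star-cut (a∈0 ∷ c∈3 ∷ e∈4 ∷ []) (here refl) =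
      window-cut a<c (proj₂ c∈3) (here refl) (there (here refl))
        (inj₁ (there (there (here (sym (∈ᵖ-chord ≤-refl e∈4))))))
        (inj₂ (both-inside (inside (proj₂ c∈3) (proj₂ a∈0) (≤-trans (start-≤ 1 3) (proj₁ c∈3)))
                           (inside (proj₂ c∈3) (<-≤-trans (proj₂ a∈0) (start-≤ 1 3)) (proj₁ c∈3))))
      where open Window _ _
            a<c = <-≤-trans (proj₂ a∈0) (≤-trans (start-≤ 1 3) (proj₁ c∈3))
    star-cut (a∈0 ∷ c∈1 ∷ e∈5 ∷ []) (there (here refl)) =
      window-cut (<-≤-trans (proj₂ a∈0) (proj₁ c∈1)) (<-≤-trans (proj₂ c∈1) (start-≤ 2 4))
        (here refl) (there (here refl))
        (inj₂ (both-outside (outside-below z≤n z≤n) (outside-above (proj₂ c∈1) (start-≤ 2 4))))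
        (inj₁ (there (there (here (sym (∈ᵖ-chord (n≤1+n 4) e∈5))))))
      where open Window _ _
    star-cut (a∈1 ∷ c∈2 ∷ e∈4 ∷ []) (there (there (here refl))) =
      window-cut (<-≤-trans (proj₂ a∈1) (proj₁ c∈2)) (<-≤-trans (proj₂ c∈2) (start-≤ 3 4))
        (here refl) (there (here refl))
        (inj₁ (there (there (here (sym (∈ᵖ-chord ≤-refl e∈4))))))
        (inj₂ (both-outside (outside-below (proj₁ a∈1) (start-≤ 1 4)) (outside-above (proj₂ c∈2) (start-≤ 3 4))))
      where open Window _ _
    star-cut (a∈2 ∷ c∈3 ∷ e∈5 ∷ []) (there (there (there (here refl)))) =
      window-cut (<-≤-trans (proj₂ a∈2) (proj₁ c∈3)) (proj₂ c∈3) (here refl) (there (here refl))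
        (inj₂ (both-outside (outside-below z≤n z≤n) (outside-below (proj₁ a∈2) (start-≤ 2 4))))
        (inj₁ (there (there (here (sym (∈ᵖ-chord (n≤1+n 4) e∈5))))))
      where open Window _ _

  n+2≡start6 : n + 2 ≡ start 6
  n+2≡start6 = sym (+-assoc n 1 1)

  n∸1+3≡n+2 : n ∸ 1 + 3 ≡ n + 2
  n∸1+3≡n+2 = trans (sym (+-assoc (n ∸ 1) 1 2)) (cong (_+ 2) (m∸n+n≡m (>-nonZero⁻¹ n)))

  GoodLabelling : ℕ → List ℕ → List ℕ → Set
  GoodLabelling d R K = Labelled R K × Increasing K × length K ≡ d × All (_< 6) K × SkeletonConnected K

  good-labelling : ∀ d {R} → R ∈ choicesOf (goodLabels d) → ∃ (GoodLabelling d R)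
  good-labelling d R∈ =
    let K , K∈ , R∼K = ∈-choicesOf⁻ (goodLabels d) R∈
        K∈c , connected = ∈-filter⁻ SkeletonConnected? {xs = combinations d (interval 0 6)} K∈
        ↑K , len , K⊆ = ∈-combinations⁻ {d} {interval 0 6} (interval-increasing 0 6) K∈c
    in K , R∼K , ↑K , len , All.tabulate (λ L∈ → proj₂ (∈-interval⁻ {0} {6} (K⊆ L∈))) , connected

  missing-without-good : ∀ d {R} → R ∈ choicesOf (goodLabels d) → missing (without (n + 2) R) ≡ R
  missing-without-good d {R} R∈ =
    let _ , R∼K , ↑K , _ , K<6 , _ = good-labelling d R∈
    in missing-without (n + 2) R (labelled-increasing ↑K R∼K)
         (subst (λ m → All (_< m) R) (sym n+2≡start6) (labelled-bounded K<6 R∼K))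

  connected-without-good : ∀ d {R} → R ∈ choicesOf (goodLabels d) → Connected ed (without (n + 2) R)
  connected-without-good d {R} R∈ =
    let _ , R∼K , ↑K , _ , _ , connected = good-labelling d R∈
    in Removing.connected-if-skeleton-connected R R∼K ↑K connected

  good-if-connected-without : ∀ {d R} → Classified d → Increasing R → All (_< start 6) R → length R ≡ d →
                              Connected ed (without (n + 2) R) → R ∈ choicesOf (goodLabels d)
  good-if-connected-without {d} {R} classified ↑R R<6 len connected =
    ∈-choicesOf⁺ (K∈ (All.lookup classified K∈c)) R∼K
    where
    open Removing R using (shared-part-cut; star-cut)
    labels = labelling R R<6
    K = proj₁ labels
    R∼K = proj₁ (proj₂ labels)
    ↑K : Increasing K
    ↑K = [ id , (λ shared → ⊥-elim (shared-part-cut shared connected)) ]′ (labels-increasing-or-shared ↑R R∼K)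
    K∈c : K ∈ combinations d (interval 0 6)
    K∈c = subst (λ k → K ∈ combinations k _) (trans (sym (Pointwise-length R∼K)) len)
            (∈-combinations (interval-increasing 0 6) ↑K
              (λ L∈ → ∈-interval⁺ z≤n (All.lookup (proj₂ (proj₂ labels)) L∈)))
    K∈ : SkeletonConnected K ⊎ K ∈ stars → K ∈ goodLabels d
    K∈ = [ ∈-filter⁺ SkeletonConnected? K∈c , (λ star → ⊥-elim (star-cut R∼K star connected)) ]′

  connected-subsets : ∀ {i d} → i + d ≡ n + 2 → Classified d → Ncoeff≡ ed i (length (choicesOf (goodLabels d)))
  connected-subsets {i} {d} i+d≡n+2 classified =
    map (without (n + 2)) Rs , unique , length-map _ Rs , λ S → sound S , complete S
    where
    open ≡-Reasoning
    Rs : List (List ℕ)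
    Rs = choicesOf (goodLabels d)

    size : ∀ S → ∣ S ∣ + length (missing S) ≡ i + d
    size S = trans (∣S∣+∣missingFrom∣≡m 0 S) (sym i+d≡n+2)

    unique : Unique (map (without (n + 2)) Rs)
    unique = Unique.map⁻ (subst Unique (sym missing∘without)
      (choicesOf-unique (Unique.filter⁺ SkeletonConnected? (combinations-unique d (interval-increasing 0 6)))))
      where missing∘without = trans (sym (map-∘ {g = missing} {f = without (n + 2)} Rs))
                                    (map-id-local (All.tabulate (missing-without-good d)))

    sound : ∀ S → S ∈ map (without (n + 2)) Rs → ∣ S ∣ ≡ i × Connected ed S
    sound S S∈ =
      let R , R∈ , S≡ = ∈-map⁻ (without (n + 2)) S∈
          _ , R∼K , _ , len , _ = good-labelling d R∈
          R≡missing = sym (trans (cong missing S≡) (missing-without-good d R∈))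
      in +-cancelʳ-≡ d _ i (begin
           ∣ S ∣ + d                  ≡⟨ cong (∣ S ∣ +_) (trans (sym len) (sym (Pointwise-length R∼K))) ⟩
           ∣ S ∣ + length R           ≡⟨ cong (λ R' → ∣ S ∣ + length R') R≡missing ⟩
           ∣ S ∣ + length (missing S) ≡⟨ size S ⟩
           i + d                      ∎) ,
         subst (Connected ed) (sym S≡) (connected-without-good d R∈)

    complete : ∀ S → ∣ S ∣ ≡ i × Connected ed S → S ∈ map (without (n + 2)) Rs
    complete S (∣S∣≡i , connected) =
      subst (_∈ map (without (n + 2)) Rs) (without-missing S) (∈-map⁺ (without (n + 2))
        (good-if-connected-without classified (missingFrom-increasing 0 S) R<6
          (+-cancelˡ-≡ i _ _ (trans (cong (_+ _) (sym ∣S∣≡i)) (size S)))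
          (subst (Connected ed) (sym (without-missing S)) connected)))
      where
      R<6 : All (_< start 6) (missing S)
      R<6 = All.tabulate (λ {r} r∈ → subst (r <_) n+2≡start6 (proj₂ (missingFrom-bounds 0 S r∈)))

  count-2 : length (choicesOf (goodLabels 2)) ≡
            1 + 2 * n + (x₁ * x₂ + x₁ * x₃ + x₁ * x₄ + x₂ * x₃ + x₂ * x₄ + x₃ * x₄)
  count-2 = trans (length-choicesOf (goodLabels 2)) (weightSum-goodLabels-2 x₁ x₂ x₃ x₄)

  count-3 : length (choicesOf (goodLabels 3)) ≡
            n + (x₁ + x₂) * (x₃ + x₄) + (x₁ + x₄) * (x₂ + x₃)
              + (x₁ * x₂ * x₃ + x₁ * x₂ * x₄ + x₁ * x₃ * x₄ + x₂ * x₃ * x₄)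
  count-3 = trans (length-choicesOf (goodLabels 3)) (weightSum-goodLabels-3 x₁ x₂ x₃ x₄)

proposition3 : (n : ℕ) .{{_ : NonZero n}} → 4 ≤ n → (x₁ x₂ x₃ x₄ : ℕ) → x₁ + x₂ + x₃ + x₄ ≡ n →
    ¬ (vtx n 0 ≡ vtx n (x₁ + x₂)) → ¬ (vtx n x₁ ≡ vtx n (x₁ + x₂ + x₃)) →
    ¬ SameEdge (chord1 n x₁ x₂ x₃) (chord2 n x₁ x₂ x₃) →
    ((i : Fin n) → ¬ SameEdge (chord1 n x₁ x₂ x₃) (cycleEdge n i)) →
    ((i : Fin n) → ¬ SameEdge (chord2 n x₁ x₂ x₃) (cycleEdge n i)) →
    Ncoeff≡ (ends n x₁ x₂ x₃) n
      (1 + 2 * n + (x₁ * x₂ + x₁ * x₃ + x₁ * x₄ + x₂ * x₃ + x₂ * x₄ + x₃ * x₄))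
    × Ncoeff≡ (ends n x₁ x₂ x₃) (n ∸ 1)
      (n + (x₁ + x₂) * (x₃ + x₄) + (x₁ + x₄) * (x₂ + x₃)
        + (x₁ * x₂ * x₃ + x₁ * x₂ * x₄ + x₁ * x₃ * x₄ + x₂ * x₃ * x₄))
proposition3 .(x₁ + x₂ + x₃ + x₄) _ x₁ x₂ x₃ x₄ refl _ _ _ _ _ =
  subst (Ncoeff≡ ed n) count-2 (connected-subsets refl classified-2) ,
  subst (Ncoeff≡ ed (n ∸ 1)) count-3 (connected-subsets n∸1+3≡n+2 classified-3)
  where open TypeA x₁ x₂ x₃ x₄
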